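{- Let $m\ge 2$ and let $G_{m,3}=S_m\Box P_3$ be the stacked-book graph with factor stars $S_m(1),S_m(2),S_m(3)$ whose central vertices are $v_1,u_1,w_1$ respectively (so $v_1 u_1 w_1$ is a path). If $M$ is an induced matching of $G_{m,3}$ containing an edge $u_1v_k$ for some vertex $v_k$ (i.e. $u_1$ is saturated by $M$), then $|M|=1$; in particular $M$ is not a maximum induced matching of $G_{m,3}$.
   Context: $S_m$ is the star graph with one central vertex and $m-1$ leaves. The stacked-book graph $G_{m,n}=S_m\Box P_n$ consists of $n$ copies $S_m(1),\dots,S_m(n)$ of $S_m$, with each vertex of $S_m(i)$ joined to the corresponding vertex of $S_m(i+1)$ for $i\in[1,n-1]$. An induced matching of a graph $G$ is a set $M$ of edges such that no two edges of $M$ share an endpoint and no edge of $G$ joins an endpoint of one edge of $M$ to an endpoint of another edge of $M$. A vertex is saturated by $M$ if it is an endpoint of an edge of $M$. -}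

module Defs where

open import Data.Nat using (ℕ; zero; suc)
open import Data.Fin using (Fin; toℕ)
open import Data.Product using (_×_; _,_; proj₁; proj₂; ∃-syntax)
open import Data.Sum using (_⊎_)
open import Data.List using (List; length; lookup)
open import Data.List.Membership.Propositional using (_∈_)
open import Relation.Binary.PropositionalEquality using (_≡_; _≢_)
open import Relation.Nullary using (¬_)

-- Star S_m on vertex set Fin m: vertex 0 is the centre, 1..m-1 are leaves.
StarAdj : {m : ℕ} → Fin m → Fin m → Set
StarAdj a b = (toℕ a ≡ 0 × toℕ b ≢ 0) ⊎ (toℕ b ≡ 0 × toℕ a ≢ 0)

-- Path P_3 on vertex set Fin 3 (layers 0,1,2 = copies S_m(1),S_m(2),S_m(3)).
PathAdj : Fin 3 → Fin 3 → Set
PathAdj i j = (toℕ i ≡ suc (toℕ j)) ⊎ (toℕ j ≡ suc (toℕ i))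

Vertex : ℕ → Set
Vertex m = Fin m × Fin 3

Adj : {m : ℕ} → Vertex m → Vertex m → Set
Adj (x , i) (y , j) = (i ≡ j × StarAdj x y) ⊎ (x ≡ y × PathAdj i j)

Edge : ℕ → Set
Edge m = Vertex m × Vertex m

Separated : {m : ℕ} → Edge m → Edge m → Set
Separated (a , b) (c , d) =
  (a ≢ c × a ≢ d × b ≢ c × b ≢ d) ×
  (¬ Adj a c × ¬ Adj a d × ¬ Adj b c × ¬ Adj b d)

-- An induced matching, given as a list of edges; |M| = length M.
-- Distinct positions must hold separated edges (so no edge is repeated).
IsInducedMatching : {m : ℕ} → List (Edge m) → Set
IsInducedMatching M =
  (∀ {e} → e ∈ M → Adj (proj₁ e) (proj₂ e)) ×
  (∀ (i j : Fin (length M)) → i ≢ j → Separated (lookup M i) (lookup M j))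

IsU1 : {m : ℕ} → Vertex m → Set
IsU1 (x , i) = toℕ x ≡ 0 × toℕ i ≡ 1

SaturatesU1 : {m : ℕ} → List (Edge m) → Set
SaturatesU1 M = ∃[ e ] (e ∈ M × (IsU1 (proj₁ e) ⊎ IsU1 (proj₂ e)))

-- The closed neighbourhood of u₁ is a vertex cover of G_{m,3}: every star edge
-- contains a centre, which is u₁ or adjacent to it, and every vertical edge
-- contains a vertex of the middle copy, which is u₁ or adjacent to it.  So any
-- edge has an endpoint equal or adjacent to u₁ and cannot be separated from an
-- edge at u₁.  Conversely, two leaf edges in the outer copies form an induced
-- matching of size 2.
module Submission where

open import Defs
open import Data.Nat using (ℕ; _≤_; _<_; suc; s≤s; z≤n)
open import Data.Nat.Properties using (n<1+n)
open import Data.Fin using (Fin; toℕ; punchIn) renaming (zero to fz; suc to fs)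
open import Data.Fin.Properties using (punchInᵢ≢i)
open import Data.List using (List; length; []; _∷_; lookup)
open import Data.List.Relation.Unary.Any using (here; there; index)
open import Data.List.Relation.Unary.Any.Properties using (lookup-index)
open import Data.List.Membership.Propositional using (_∈_)
open import Data.List.Membership.Propositional.Properties using (∈-lookup)
open import Data.Product using (_×_; ∃-syntax; _,_; proj₁)
open import Data.Sum using (_⊎_; inj₁; inj₂; [_,_]′) renaming (map to ⊎-map)
open import Function using (_∘_)
open import Relation.Nullary using (¬_; contradiction)
open import Relation.Binary.PropositionalEquality using (_≡_; refl; sym; _≢_; subst)

IsEdge : {m : ℕ} → Edge m → Set
IsEdge (a , b) = Adj a b

Endpoint : {m : ℕ} → Vertex m → Edge m → Set
Endpoint v (a , b) = v ≡ a ⊎ v ≡ b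

ClosedNbhd : {m : ℕ} → Vertex m → Vertex m → Set
ClosedNbhd v w = v ≡ w ⊎ Adj v w

separated-endpoints : {m : ℕ} {e f : Edge m} {p q : Vertex m} →
  Separated e f → Endpoint p e → Endpoint q f → p ≢ q × ¬ Adj p q
separated-endpoints ((≢₁ , _ , _ , _) , (¬adj₁ , _ , _ , _)) (inj₁ refl) (inj₁ refl) = ≢₁ , ¬adj₁
separated-endpoints ((_ , ≢₂ , _ , _) , (_ , ¬adj₂ , _ , _)) (inj₁ refl) (inj₂ refl) = ≢₂ , ¬adj₂
separated-endpoints ((_ , _ , ≢₃ , _) , (_ , _ , ¬adj₃ , _)) (inj₂ refl) (inj₁ refl) = ≢₃ , ¬adj₃
separated-endpoints ((_ , _ , _ , ≢₄) , (_ , _ , _ , ¬adj₄)) (inj₂ refl) (inj₂ refl) = ≢₄ , ¬adj₄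

separated⇒¬closedNbhd : {m : ℕ} {e f : Edge m} {p q : Vertex m} →
  Separated e f → Endpoint p e → Endpoint q f → ¬ ClosedNbhd p q
separated⇒¬closedNbhd sep p∈e q∈f =
  let p≢q , ¬adj = separated-endpoints sep p∈e q∈f in [ p≢q , ¬adj ]′

isolated-edge⇒length≡1 : {m : ℕ} {M : List (Edge m)} {e : Edge m} →
  IsInducedMatching M → e ∈ M → (∀ {f} → IsEdge f → ¬ Separated e f) → length M ≡ 1
isolated-edge⇒length≡1 {M = []} _ () _
isolated-edge⇒length≡1 {M = _ ∷ []} _ _ _ = refl
isolated-edge⇒length≡1 {M = M@(_ ∷ _ ∷ _)} {e} (isEdge , separated) e∈M isolated =
  contradiction e-separated-from-other (isolated (isEdge (∈-lookup j)))
  where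
  i : Fin (length M)
  i = index e∈M
  j : Fin (length M)
  j = punchIn i fz
  e-separated-from-other : Separated e (lookup M j)
  e-separated-from-other =
    subst (λ e′ → Separated e′ (lookup M j)) (sym (lookup-index e∈M)) (separated i j (punchInᵢ≢i i fz ∘ sym))

u₁ : {n : ℕ} → Vertex (suc n)
u₁ = fz , fs fz

isU1⇒≡u₁ : {n : ℕ} {v : Vertex (suc n)} → IsU1 v → v ≡ u₁
isU1⇒≡u₁ {v = fz , fs fz} _ = refl
isU1⇒≡u₁ {v = fz , fz} (_ , ())
isU1⇒≡u₁ {v = fz , fs (fs fz)} (_ , ())
isU1⇒≡u₁ {v = fs _ , _} (() , _)

saturatesU1⇒endpoint : {n : ℕ} {M : List (Edge (suc n))} →
  SaturatesU1 M → ∃[ e ] (e ∈ M × Endpoint u₁ e)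
saturatesU1⇒endpoint (e , e∈M , u₁∈e) = e , e∈M , ⊎-map (sym ∘ isU1⇒≡u₁) (sym ∘ isU1⇒≡u₁) u₁∈e

centre∈closedNbhd-u₁ : {n : ℕ} {x : Fin (suc n)} {i : Fin 3} → toℕ x ≡ 0 → ClosedNbhd u₁ (x , i)
centre∈closedNbhd-u₁ {x = fz} {fz} _ = inj₂ (inj₂ (refl , inj₁ refl))
centre∈closedNbhd-u₁ {x = fz} {fs fz} _ = inj₁ refl
centre∈closedNbhd-u₁ {x = fz} {fs (fs fz)} _ = inj₂ (inj₂ (refl , inj₂ refl))

middle∈closedNbhd-u₁ : {n : ℕ} {x : Fin (suc n)} {i : Fin 3} → toℕ i ≡ 1 → ClosedNbhd u₁ (x , i)
middle∈closedNbhd-u₁ {x = fz} {fs fz} _ = inj₁ refl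
middle∈closedNbhd-u₁ {x = fs _} {fs fz} _ = inj₂ (inj₁ (refl , inj₁ (refl , λ ())))

starAdj-centre : {m : ℕ} {x y : Fin m} → StarAdj x y → toℕ x ≡ 0 ⊎ toℕ y ≡ 0
starAdj-centre = ⊎-map proj₁ proj₁

pathAdj-middle : {i j : Fin 3} → PathAdj i j → toℕ i ≡ 1 ⊎ toℕ j ≡ 1
pathAdj-middle {fs fz} _ = inj₁ refl
pathAdj-middle {fz} {fs fz} _ = inj₂ refl
pathAdj-middle {fs (fs fz)} {fs fz} _ = inj₂ refl
pathAdj-middle {fz} {fz} (inj₁ ())
pathAdj-middle {fz} {fz} (inj₂ ())
pathAdj-middle {fz} {fs (fs fz)} (inj₁ ())
pathAdj-middle {fz} {fs (fs fz)} (inj₂ ())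
pathAdj-middle {fs (fs fz)} {fz} (inj₁ ())
pathAdj-middle {fs (fs fz)} {fz} (inj₂ ())
pathAdj-middle {fs (fs fz)} {fs (fs fz)} (inj₁ ())
pathAdj-middle {fs (fs fz)} {fs (fs fz)} (inj₂ ())

closedNbhd-u₁-covers : {n : ℕ} {a b : Vertex (suc n)} → Adj a b → ClosedNbhd u₁ a ⊎ ClosedNbhd u₁ b
closedNbhd-u₁-covers (inj₁ (refl , xy)) = ⊎-map centre∈closedNbhd-u₁ centre∈closedNbhd-u₁ (starAdj-centre xy)
closedNbhd-u₁-covers (inj₂ (refl , ij)) = ⊎-map middle∈closedNbhd-u₁ middle∈closedNbhd-u₁ (pathAdj-middle ij)

u₁-edge-isolated : {n : ℕ} {e f : Edge (suc n)} → Endpoint u₁ e → IsEdge f → ¬ Separated e f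
u₁-edge-isolated u₁∈e adj sep =
  [ separated⇒¬closedNbhd sep u₁∈e (inj₁ refl) , separated⇒¬closedNbhd sep u₁∈e (inj₂ refl) ]′
    (closedNbhd-u₁-covers adj)

¬adj-layer₀-layer₂ : {m : ℕ} {x y : Fin m} → ¬ Adj (x , fz) (y , fs (fs fz))
¬adj-layer₀-layer₂ (inj₁ (() , _))
¬adj-layer₀-layer₂ (inj₂ (_ , inj₁ ()))
¬adj-layer₀-layer₂ (inj₂ (_ , inj₂ ()))

¬adj-layer₂-layer₀ : {m : ℕ} {x y : Fin m} → ¬ Adj (x , fs (fs fz)) (y , fz)
¬adj-layer₂-layer₀ (inj₁ (() , _))
¬adj-layer₂-layer₀ (inj₂ (_ , inj₁ ()))
¬adj-layer₂-layer₀ (inj₂ (_ , inj₂ ()))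

leafEdge : {n : ℕ} → Fin 3 → Edge (suc (suc n))
leafEdge i = (fz , i) , (fs fz , i)

outerLeafEdges : {n : ℕ} → List (Edge (suc (suc n)))
outerLeafEdges = leafEdge fz ∷ leafEdge (fs (fs fz)) ∷ []

outerLeafEdges-induced : {n : ℕ} → IsInducedMatching (outerLeafEdges {n})
outerLeafEdges-induced = isEdge , separated
  where
  isEdge : ∀ {e} → e ∈ outerLeafEdges → IsEdge e
  isEdge (here refl) = inj₁ (refl , inj₁ (refl , λ ()))
  isEdge (there (here refl)) = inj₁ (refl , inj₁ (refl , λ ()))
  separated : (i j : Fin 2) → i ≢ j → Separated (lookup outerLeafEdges i) (lookup outerLeafEdges j)
  separated fz fz i≢i = contradiction refl i≢i
  separated (fs fz) (fs fz) i≢i = contradiction refl i≢i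
  separated fz (fs fz) _ = ((λ ()) , (λ ()) , (λ ()) , (λ ())) ,
    (¬adj-layer₀-layer₂ , ¬adj-layer₀-layer₂ , ¬adj-layer₀-layer₂ , ¬adj-layer₀-layer₂)
  separated (fs fz) fz _ = ((λ ()) , (λ ()) , (λ ()) , (λ ())) ,
    (¬adj-layer₂-layer₀ , ¬adj-layer₂-layer₀ , ¬adj-layer₂-layer₀ , ¬adj-layer₂-layer₀)

lemma3 : (m : ℕ) → 2 ≤ m → (M : List (Edge m)) → IsInducedMatching M → SaturatesU1 M →
    length M ≡ 1 × ∃[ M' ] (IsInducedMatching {m} M' × length M < length M')
lemma3 (suc (suc n)) (s≤s (s≤s z≤n)) M matching saturated =
  length≡1 , outerLeafEdges , outerLeafEdges-induced , subst (_< 2) (sym length≡1) (n<1+n 1)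
  where
  length≡1 : length M ≡ 1
  length≡1 with saturatesU1⇒endpoint saturated
  ... | e , e∈M , u₁∈e = isolated-edge⇒length≡1 matching e∈M (u₁-edge-isolated u₁∈e)
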